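{- Let $n,k$ be integers with $k\ge1$, $n>2k$, and write $g=\gcd(n,k)$. (a) If $n/g$ is odd, then $\beta(P(n,k))\le n+\frac{n+g}{4}$. (b) If $n/g$ is even, then $\beta(P(n,k))\le n+\frac{n}{4}$.
   Context: $P(n,k)$ is the generalized Petersen graph with vertices $u_1,\dots,u_n,v_1,\dots,v_n$ and edges $u_iu_{i+1}$, $u_iv_i$, $v_iv_{i+k}$ (subscripts modulo $n$). $\beta(G)$ denotes the size of a minimum vertex cover of $G$. -}

module Defs where

open import Data.Nat using (ℕ; zero; suc; _+_; _*_; _/_; _%_; _≤_)
open import Data.Nat.DivMod using (m%n<n)
open import Data.Nat.GCD using (gcd; gcd[m,n]≢0)
open import Data.Nat.Base using (≢-nonZero)
open import Data.Fin using (Fin; toℕ; fromℕ<)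
open import Data.Fin.Subset using (Subset; _∈_; ∣_∣)
open import Data.Sum using (_⊎_; inj₁)
open import Data.Product using (Σ; _×_)

_⊕_ : ∀ {n} → Fin n → ℕ → Fin n
_⊕_ {suc m} i j = fromℕ< (m%n<n (toℕ i + j) (suc m))

data Vertex (n : ℕ) : Set where
  u : Fin n → Vertex n
  v : Fin n → Vertex n

data PEdge (n k : ℕ) : Vertex n → Vertex n → Set where
  outer : (i : Fin n) → PEdge n k (u i) (u (i ⊕ 1))
  spoke : (i : Fin n) → PEdge n k (u i) (v i)
  inner : (i : Fin n) → PEdge n k (v i) (v (i ⊕ k))

record VSet (n : ℕ) : Set where
  constructor vset
  field
    outerPart : Subset n
    innerPart : Subset n

_∈V_ : ∀ {n} → Vertex n → VSet n → Set
u i ∈V S = i ∈ VSet.outerPart S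
v i ∈V S = i ∈ VSet.innerPart S

size : ∀ {n} → VSet n → ℕ
size S = ∣ VSet.outerPart S ∣ + ∣ VSet.innerPart S ∣

IsVertexCover : (n k : ℕ) → VSet (n) → Set
IsVertexCover n k S = ∀ x y → PEdge n k x y → x ∈V S ⊎ y ∈V S

-- β(P(n,k)) ≤ m  :⇔  P(n,k) has a vertex cover of size at most m
-- (β is the minimum size of a vertex cover).
β≤ : (n k m : ℕ) → Set
β≤ n k m = Σ (VSet n) λ S → IsVertexCover n k S × size S ≤ m

-- n / gcd(n,k)  (for n = 0 we return 0; irrelevant since n > 2k ≥ 2 below).
nOverG : ℕ → ℕ → ℕ
nOverG zero k = zero
nOverG (suc m) k =
  let instance _ = ≢-nonZero (gcd[m,n]≢0 (suc m) k (inj₁ λ ())) in suc m / gcd (suc m) k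

module Submission where

-- Write g = gcd(n,k), n = m·g and k = k'·g.  The inner vertices v_i form g
-- cycles of length m; choosing z with z·k' ≡ 1 (mod m), the number
-- pos(i) = (⌊i/g⌋·z) mod m is the position of v_i on its cycle, since
-- pos(i+k) ≡ pos(i)+1 (mod m).
--
-- 1. Any set c of inner indices covering all inner edges and missing some
--    index a extends to a vertex cover: add u_i for i ∉ c, and on the
--    outer cycle, cut open at a, alternately every other u_i with i ∈ c.
--    Both alternating choices are covers; their sizes sum to 2n + |c|.
-- 2. Hence two such inner covers c₁, c₂ give β ≤ ⌊(4n + |c₁| + |c₂|)/4⌋.
-- 3. Inner covers from positions: "pos even" always works, "pos odd"
--    works when m is even, "pos odd or pos = 0" always works.  Position 0
--    only occurs for the g indices i < g.  So |c₁| + |c₂| is n when m is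
--    even and at most n + g in general (the latter needs m ≥ 3, which holds
--    when m is odd since n > 2k forces m ≥ 2).

open import Defs
open import Data.Bool using (Bool; true; false; not; _∨_; _xor_)
open import Data.Bool.Properties using (∨-zeroʳ; T-≡)
open import Function.Bundles using (Equivalence)
open import Data.Fin using (Fin; zero; suc; toℕ; fromℕ<)
open import Data.Fin.Properties using (toℕ-fromℕ<; toℕ-injective; toℕ<n)
open import Data.Fin.Subset using (_∈_; ∁; ∣_∣)
open import Data.Fin.Subset.Properties using (p⊆q⇒∣p∣≤∣q∣; ∣∁p∣≡n∸∣p∣; ∣p∣≤n)
open import Data.Nat
  using (ℕ; zero; suc; _+_; _*_; _∸_; _/_; _%_; _≤_; _<_; _≤?_; _<ᵇ_; _≡ᵇ_; z≤n; s≤s; NonZero; >-nonZero; ≢-nonZero)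
open import Data.Nat.Coprimality using (Coprime; coprime-Bézout; coprime-/gcd)
open import Data.Nat.DivMod
open import Data.Nat.Divisibility using (_∣_; divides; ∣⇒≤)
open import Data.Nat.GCD using (gcd; gcd[m,n]∣m; gcd[m,n]∣n; gcd[m,n]≢0; module Bézout)
open import Data.Nat.Properties
open import Algebra.Properties.CommutativeMonoid.Sum +-0-commutativeMonoid
  using (sum; ∑-distrib-+; sum-cong-≗)
open import Algebra.Properties.CommutativeSemigroup *-commutativeSemigroup using (xy∙z≈xz∙y)
open import Data.Nat.Solver using (module +-*-Solver)
open import Data.Product using (Σ; ∃; _×_; _,_; proj₁; proj₂)
open import Data.Sum using (_⊎_; inj₁; inj₂)
import Data.Sum as Sum
open import Data.Vec using (tabulate)
open import Data.Vec.Properties using (lookup∘tabulate; lookup⇒[]=; []=⇒lookup; tabulate-∘)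
open import Function using (_∘_)
open import Relation.Binary.PropositionalEquality
open import Relation.Nullary using (yes; no; contradiction)

even : ℕ → Bool
even zero = true
even (suc zero) = false
even (suc (suc t)) = even t

even-suc : ∀ t → even (suc t) ≡ not (even t)
even-suc zero = refl
even-suc (suc zero) = refl
even-suc (suc (suc t)) = even-suc t

%2≡0⇒even : ∀ t → t % 2 ≡ 0 → even t ≡ true
%2≡0⇒even zero _ = refl
%2≡0⇒even (suc zero) ()
%2≡0⇒even (suc (suc t)) h = %2≡0⇒even t h

⟦_⟧ : Bool → ℕ
⟦ true ⟧ = 1
⟦ false ⟧ = 0

count : ∀ {n} → (Fin n → Bool) → ℕ
count f = ∣ tabulate f ∣

∈-tabulate : ∀ {n} (f : Fin n → Bool) {i} → f i ≡ true → i ∈ tabulate f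
∈-tabulate f {i} fi = lookup⇒[]= i (tabulate f) (trans (lookup∘tabulate f i) fi)

tabulate-∈ : ∀ {n} (f : Fin n → Bool) {i} → i ∈ tabulate f → f i ≡ true
tabulate-∈ f {i} i∈ = trans (sym (lookup∘tabulate f i)) ([]=⇒lookup i∈)

count-mono : ∀ {n} (f h : Fin n → Bool) → (∀ i → f i ≡ true → h i ≡ true) → count f ≤ count h
count-mono f h f⇒h = p⊆q⇒∣p∣≤∣q∣ (∈-tabulate h ∘ f⇒h _ ∘ tabulate-∈ f)

count≡∑ : ∀ {n} (f : Fin n → Bool) → count f ≡ sum (⟦_⟧ ∘ f)
count≡∑ {zero} f = refl
count≡∑ {suc n} f with f zero
... | true = cong suc (count≡∑ (f ∘ suc))
... | false = count≡∑ (f ∘ suc)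

∑-const+ : ∀ {n} a (h : Fin n → ℕ) → sum (λ i → a + h i) ≡ n * a + sum h
∑-const+ {n} a h = trans (∑-distrib-+ (λ _ → a) h) (cong (_+ sum h) (∑-const n))
  where
  ∑-const : ∀ n → sum {n} (λ _ → a) ≡ n * a
  ∑-const zero = refl
  ∑-const (suc n) = cong (a +_) (∑-const n)

count-+ : ∀ {n} (f h : Fin n → Bool) → count f + count h ≡ sum (λ i → ⟦ f i ⟧ + ⟦ h i ⟧)
count-+ f h = trans (cong₂ _+_ (count≡∑ f) (count≡∑ h)) (sym (∑-distrib-+ (⟦_⟧ ∘ f) (⟦_⟧ ∘ h)))

count-complement : ∀ {n} (f : Fin n → Bool) → count f + count (not ∘ f) ≡ n
count-complement {n} f = begin
  count f + count (not ∘ f)       ≡⟨ cong (λ p → count f + ∣ p ∣) (tabulate-∘ not f) ⟩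
  count f + ∣ ∁ (tabulate f) ∣    ≡⟨ cong (count f +_) (∣∁p∣≡n∸∣p∣ (tabulate f)) ⟩
  count f + (n ∸ count f)         ≡⟨ m+[n∸m]≡n (∣p∣≤n (tabulate f)) ⟩
  n                               ∎
  where open ≡-Reasoning

count-initial : ∀ {n} g → count {n} (λ i → toℕ i <ᵇ g) ≤ g
count-initial {zero} g = z≤n
count-initial {suc n} zero = count-initial {n} zero
count-initial {suc n} (suc g) = s≤s (count-initial {n} g)

toℕ-⊕ : ∀ {n} .{{_ : NonZero n}} (i : Fin n) j → toℕ (i ⊕ j) ≡ (toℕ i + j) % n
toℕ-⊕ {suc _} i j = toℕ-fromℕ< _

%-cong-+ : ∀ {a a' b b'} m .{{_ : NonZero m}} → a % m ≡ a' % m → b % m ≡ b' % m →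
           (a + b) % m ≡ (a' + b') % m
%-cong-+ {a} {a'} {b} {b'} m ha hb = begin
  (a + b) % m            ≡⟨ %-distribˡ-+ a b m ⟩
  (a % m + b % m) % m    ≡⟨ cong₂ (λ x y → (x + y) % m) ha hb ⟩
  (a' % m + b' % m) % m  ≡⟨ %-distribˡ-+ a' b' m ⟨
  (a' + b') % m          ∎
  where open ≡-Reasoning

%-cong-* : ∀ {a a' b b'} m .{{_ : NonZero m}} → a % m ≡ a' % m → b % m ≡ b' % m →
           (a * b) % m ≡ (a' * b') % m
%-cong-* {a} {a'} {b} {b'} m ha hb = begin
  (a * b) % m              ≡⟨ %-distribˡ-* a b m ⟩
  ((a % m) * (b % m)) % m  ≡⟨ cong₂ (λ x y → (x * y) % m) ha hb ⟩
  ((a' % m) * (b' % m)) % m ≡⟨ %-distribˡ-* a' b' m ⟨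
  (a' * b') % m            ∎
  where open ≡-Reasoning

suc-mod : ∀ {t m} .{{_ : NonZero m}} → t < m → suc t % m ≡ suc t ⊎ (suc t % m ≡ 0 × suc t ≡ m)
suc-mod {t} {m} t<m with m≤n⇒m<n∨m≡n t<m
... | inj₁ st<m = inj₁ (m<n⇒m%n≡m st<m)
... | inj₂ st≡m = inj₂ (trans (cong (_% m) st≡m) (n%n≡0 m) , st≡m)

modular-inverse : ∀ {m k'} .{{_ : NonZero m}} → Coprime m k' → ∃ λ z → (z * k') % m ≡ 1 % m
modular-inverse {m@(suc m₁)} {k'} coprime with coprime-Bézout coprime
... | Bézout.-+ x y 1+xm≡yk' = y , sym (trans (sym ([m+kn]%n≡m%n 1 x m)) (cong (_% m) 1+xm≡yk'))
... | Bézout.+- x y 1+yk'≡xm = y * m₁ , (begin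
  (y * m₁ * k') % m            ≡⟨ [m+kn]%n≡m%n (y * m₁ * k') x m ⟨
  (y * m₁ * k' + x * m) % m    ≡⟨ cong (λ t → (y * m₁ * k' + t) % m) (sym 1+yk'≡xm) ⟩
  (y * m₁ * k' + (1 + y * k')) % m
    ≡⟨ cong (_% m) (solve 3 (λ y m₁ k' → y :* m₁ :* k' :+ (con 1 :+ y :* k')
                                       := con 1 :+ y :* k' :* (con 1 :+ m₁)) refl y m₁ k') ⟩
  (1 + y * k' * m) % m         ≡⟨ [m+kn]%n≡m%n 1 (y * k') m ⟩
  1 % m                        ∎)
  where
  open ≡-Reasoning
  open +-*-Solver

-- Walking around the n-cycle starting at A, index x is reached after
-- unroll x steps (minus A): indices before A are shifted by n.
module CycleCut (n A : ℕ) .{{_ : NonZero n}} where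

  unroll : ℕ → ℕ
  unroll x with A ≤? x
  ... | yes _ = x
  ... | no _ = x + n

  unroll-suc : ∀ {x} → x < n → A < n → suc x % n ≢ A → unroll (suc x % n) ≡ suc (unroll x)
  unroll-suc {x} x<n A<n next≢A with suc-mod x<n
  ... | inj₁ next≡ = trans (cong unroll next≡) (step (next≢A ∘ trans next≡))
    where
    step : suc x ≢ A → unroll (suc x) ≡ suc (unroll x)
    step sx≢A with A ≤? suc x | A ≤? x
    ... | yes _    | yes _   = refl
    ... | yes A≤sx | no A≰x with m≤n⇒m<n∨m≡n A≤sx
    ...   | inj₁ A<sx = contradiction (≤-pred A<sx) A≰x
    ...   | inj₂ A≡sx = contradiction (sym A≡sx) sx≢A
    step sx≢A | no A≰sx | yes A≤x = contradiction (m≤n⇒m≤1+n A≤x) A≰sx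
    step sx≢A | no _    | no _    = refl
  ... | inj₂ (next≡0 , sx≡n) = trans (cong unroll next≡0) (wrap (next≢A ∘ trans next≡0))
    where
    wrap : 0 ≢ A → unroll 0 ≡ suc (unroll x)
    wrap 0≢A with A ≤? 0 | A ≤? x
    ... | yes A≤0 | _       = contradiction (sym (n≤0⇒n≡0 A≤0)) 0≢A
    ... | no _    | yes _   = sym sx≡n
    ... | no _    | no A≰x  = contradiction (≤-pred (subst (A <_) (sym sx≡n) A<n)) A≰x

2*≤+ : ∀ {x y} → x ≤ y → 2 * x ≤ x + y
2*≤+ {x} x≤y = +-monoʳ-≤ x (subst (_≤ _) (sym (+-identityʳ x)) x≤y)

smaller : ∀ {n k} {S T : VSet n} → IsVertexCover n k S → IsVertexCover n k T →
          Σ (VSet n) λ U → IsVertexCover n k U × 2 * size U ≤ size S + size T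
smaller {S = S} {T} S-cover T-cover with size S ≤? size T
... | yes S≤T = S , S-cover , 2*≤+ S≤T
... | no S≰T = T , T-cover , subst (2 * size T ≤_) (+-comm (size T) (size S)) (2*≤+ (≰⇒≥ S≰T))

≤-/ : ∀ d {x T} .{{_ : NonZero d}} → d * x ≤ T → x ≤ T / d
≤-/ d {x} {T} dx≤T = subst (_≤ _) (m*n/n≡m x d) (/-monoˡ-≤ d (subst (_≤ T) (*-comm d x) dx≤T))

InnerCover : (n k : ℕ) → (Fin n → Bool) → Set
InnerCover n k c = ∀ i → c i ≡ true ⊎ c (i ⊕ k) ≡ true

xor-alternative : ∀ p b → p xor b ≡ true ⊎ not p xor b ≡ true
xor-alternative true true = inj₂ refl
xor-alternative true false = inj₁ refl
xor-alternative false true = inj₁ refl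
xor-alternative false false = inj₂ refl

module Extension {n k} .{{_ : NonZero n}} (c : Fin n → Bool) (c-cover : InnerCover n k c)
                 (a : Fin n) (a∉c : c a ≡ false) where

  colour : Fin n → Bool
  colour i = even (unroll (toℕ i))
    where open CycleCut n (toℕ a)

  colour-alternates : ∀ i → i ⊕ 1 ≢ a → colour (i ⊕ 1) ≡ not (colour i)
  colour-alternates i i⊕1≢a = begin
    even (unroll (toℕ (i ⊕ 1)))       ≡⟨ cong (even ∘ unroll) toℕ-next ⟩
    even (unroll (suc (toℕ i) % n))   ≡⟨ cong even (unroll-suc (toℕ<n i) (toℕ<n a) next≢a) ⟩
    even (suc (unroll (toℕ i)))       ≡⟨ even-suc (unroll (toℕ i)) ⟩
    not (colour i)                    ∎
    where
    open ≡-Reasoning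
    open CycleCut n (toℕ a)
    toℕ-next : toℕ (i ⊕ 1) ≡ suc (toℕ i) % n
    toℕ-next = trans (toℕ-⊕ i 1) (cong (_% n) (+-comm (toℕ i) 1))
    next≢a : suc (toℕ i) % n ≢ toℕ a
    next≢a eq = i⊕1≢a (toℕ-injective (trans toℕ-next eq))

  outerChoice : Bool → Fin n → Bool
  outerChoice b i = not (c i) ∨ (colour i xor b)

  extension : Bool → VSet n
  extension b = vset (tabulate (outerChoice b)) (tabulate c)

  uncovered⇒chosen : ∀ b i → c i ≡ false → outerChoice b i ≡ true
  uncovered⇒chosen b i ci = cong (λ x → not x ∨ (colour i xor b)) ci

  coloured⇒chosen : ∀ b i → colour i xor b ≡ true → outerChoice b i ≡ true
  coloured⇒chosen b i e = trans (cong (not (c i) ∨_) e) (∨-zeroʳ (not (c i)))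

  outer-covered : ∀ b i → outerChoice b i ≡ true ⊎ outerChoice b (i ⊕ 1) ≡ true
  outer-covered b i = by-membership (c i) refl (c (i ⊕ 1)) refl
    where
    by-membership : ∀ x → c i ≡ x → ∀ y → c (i ⊕ 1) ≡ y →
                    outerChoice b i ≡ true ⊎ outerChoice b (i ⊕ 1) ≡ true
    by-membership false ci _     _  = inj₁ (uncovered⇒chosen b i ci)
    by-membership true  _  false cj = inj₂ (uncovered⇒chosen b (i ⊕ 1) cj)
    by-membership true  _  true  cj with xor-alternative (colour i) b
    ... | inj₁ e = inj₁ (coloured⇒chosen b i e)
    ... | inj₂ e = inj₂ (coloured⇒chosen b (i ⊕ 1) (trans (cong (_xor b) (colour-alternates i i⊕1≢a)) e))
      where
      i⊕1≢a : i ⊕ 1 ≢ a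
      i⊕1≢a refl = contradiction (trans (sym cj) a∉c) λ ()

  spoke-covered : ∀ b i → outerChoice b i ≡ true ⊎ c i ≡ true
  spoke-covered b i = by-membership (c i) refl
    where
    by-membership : ∀ x → c i ≡ x → outerChoice b i ≡ true ⊎ c i ≡ true
    by-membership true  ci = inj₂ ci
    by-membership false ci = inj₁ (uncovered⇒chosen b i ci)

  extension-cover : ∀ b → IsVertexCover n k (extension b)
  extension-cover b _ _ (outer i) = Sum.map (∈-tabulate _) (∈-tabulate _) (outer-covered b i)
  extension-cover b _ _ (spoke i) = Sum.map (∈-tabulate _) (∈-tabulate c) (spoke-covered b i)
  extension-cover b _ _ (inner i) = Sum.map (∈-tabulate c) (∈-tabulate c) (c-cover i)

  -- Per index: u_i is in both extensions if i ∉ c, in exactly one if i ∈ c.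
  extension-sizes : size (extension false) + size (extension true) ≡ 2 * n + count c
  extension-sizes = begin
    (count (outerChoice false) + count c) + (count (outerChoice true) + count c)
      ≡⟨ cong₂ _+_ (count-+ (outerChoice false) c) (count-+ (outerChoice true) c) ⟩
    sum (λ i → ⟦ outerChoice false i ⟧ + ⟦ c i ⟧) + sum (λ i → ⟦ outerChoice true i ⟧ + ⟦ c i ⟧)
      ≡⟨ ∑-distrib-+ (λ i → ⟦ outerChoice false i ⟧ + ⟦ c i ⟧) (λ i → ⟦ outerChoice true i ⟧ + ⟦ c i ⟧) ⟨
    sum (λ i → (⟦ outerChoice false i ⟧ + ⟦ c i ⟧) + (⟦ outerChoice true i ⟧ + ⟦ c i ⟧))
      ≡⟨ sum-cong-≗ (λ i → pointwise (c i) (colour i)) ⟩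
    sum (λ i → 2 + ⟦ c i ⟧)
      ≡⟨ ∑-const+ 2 (⟦_⟧ ∘ c) ⟩
    n * 2 + sum (⟦_⟧ ∘ c)
      ≡⟨ cong₂ _+_ (*-comm 2 n) (count≡∑ c) ⟨
    2 * n + count c ∎
    where
    open ≡-Reasoning
    pointwise : ∀ x p → (⟦ not x ∨ (p xor false) ⟧ + ⟦ x ⟧) + (⟦ not x ∨ (p xor true) ⟧ + ⟦ x ⟧) ≡ 2 + ⟦ x ⟧
    pointwise false _ = refl
    pointwise true true = refl
    pointwise true false = refl

  extension-bound : Σ (VSet n) λ U → IsVertexCover n k U × 2 * size U ≤ 2 * n + count c
  extension-bound with smaller (extension-cover false) (extension-cover true)
  ... | U , U-cover , bound = U , U-cover , subst (2 * size U ≤_) extension-sizes bound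

β≤-from-inner-covers : ∀ {n k T} .{{_ : NonZero n}} {c₁ c₂ : Fin n → Bool} {a₁ a₂ : Fin n} →
  InnerCover n k c₁ → c₁ a₁ ≡ false → InnerCover n k c₂ → c₂ a₂ ≡ false →
  4 * n + (count c₁ + count c₂) ≤ T → β≤ n k (T / 4)
β≤-from-inner-covers {n} {k} {T} {c₁} {c₂} {a₁} {a₂} cover₁ a₁∉c₁ cover₂ a₂∉c₂ bound
  with Extension.extension-bound c₁ cover₁ a₁ a₁∉c₁ | Extension.extension-bound c₂ cover₂ a₂ a₂∉c₂
... | U₁ , U₁-cover , bound₁ | U₂ , U₂-cover , bound₂ with smaller U₁-cover U₂-cover
... | W , W-cover , boundW = W , W-cover , ≤-/ 4 (begin
  4 * size W                               ≡⟨ *-assoc 2 2 (size W) ⟩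
  2 * (2 * size W)                         ≤⟨ *-monoʳ-≤ 2 boundW ⟩
  2 * (size U₁ + size U₂)                  ≡⟨ *-distribˡ-+ 2 (size U₁) (size U₂) ⟩
  2 * size U₁ + 2 * size U₂                ≤⟨ +-mono-≤ bound₁ bound₂ ⟩
  (2 * n + count c₁) + (2 * n + count c₂)  ≡⟨ +-*-Solver.solve 3 (λ n x y →
                                                (con 2 :* n :+ x) :+ (con 2 :* n :+ y)
                                                := con 4 :* n :+ (x :+ y)) refl n (count c₁) (count c₂) ⟩
  4 * n + (count c₁ + count c₂)            ≤⟨ bound ⟩
  T                                        ∎)
  where open ≤-Reasoning
        open +-*-Solver using (con; _:*_; _:+_; _:=_)

-- For n = m·g and k = k'·g with m, k' coprime, pos i is the position of
-- v_i on its inner cycle (the cycles are the residue classes mod g).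
module InnerPositions {n k m g k' : ℕ} .{{_ : NonZero n}} .{{_ : NonZero m}} .{{_ : NonZero g}}
                      (n≡ : n ≡ m * g) (k≡ : k ≡ k' * g) (coprime : Coprime m k') where

  private
    z : ℕ
    z = proj₁ (modular-inverse coprime)

    zk'≡1 : (k' * z) % m ≡ 1 % m
    zk'≡1 = trans (cong (_% m) (*-comm k' z)) (proj₂ (modular-inverse coprime))

    instance
      mg≢0 : NonZero (m * g)
      mg≢0 = m*n≢0 m g

    quotient-mod : ∀ x → (x % n) / g ≡ (x / g) % m
    quotient-mod x = trans (/-congˡ (%-congʳ n≡)) (m%[n*o]/o≡m/o%n x m g)

    k/g≡k' : k / g ≡ k'
    k/g≡k' = trans (/-congˡ k≡) (m*n/n≡m k' g)

    cancel-k'z : ∀ t → (t * k' * z) % m ≡ t % m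
    cancel-k'z t = begin
      (t * k' * z) % m    ≡⟨ cong (_% m) (*-assoc t k' z) ⟩
      (t * (k' * z)) % m  ≡⟨ %-cong-* {t} m refl zk'≡1 ⟩
      (t * 1) % m         ≡⟨ cong (_% m) (*-identityʳ t) ⟩
      t % m               ∎
      where open ≡-Reasoning

  pos : Fin n → ℕ
  pos i = (toℕ i / g * z) % m

  pos<m : ∀ i → pos i < m
  pos<m i = m%n<n _ m

  pos-step : ∀ i → pos (i ⊕ k) ≡ suc (pos i) % m
  pos-step i = begin
    (toℕ (i ⊕ k) / g * z) % m              ≡⟨ cong (λ x → (x / g * z) % m) (toℕ-⊕ i k) ⟩
    ((toℕ i + k) % n / g * z) % m          ≡⟨ cong (λ x → (x * z) % m) (quotient-mod (toℕ i + k)) ⟩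
    ((toℕ i + k) / g % m * z) % m          ≡⟨ %-cong-* m (m%n%n≡m%n _ m) refl ⟩
    ((toℕ i + k) / g * z) % m              ≡⟨ cong (λ x → (x * z) % m) (+-distrib-/-∣ʳ (toℕ i) g∣k) ⟩
    ((toℕ i / g + k / g) * z) % m          ≡⟨ cong (λ x → ((toℕ i / g + x) * z) % m) k/g≡k' ⟩
    ((toℕ i / g + k') * z) % m             ≡⟨ cong (_% m) (*-distribʳ-+ z (toℕ i / g) k') ⟩
    (toℕ i / g * z + k' * z) % m           ≡⟨ %-cong-+ m (sym (m%n%n≡m%n _ m)) zk'≡1 ⟩
    (pos i + 1) % m                        ≡⟨ cong (_% m) (+-comm (pos i) 1) ⟩
    suc (pos i) % m                        ∎
    where
    open ≡-Reasoning
    g∣k : g ∣ k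
    g∣k = divides k' k≡

  -- Every residue mod m occurs as a position (at the index t·k mod n).
  pos-onto : ∀ t → ∃ λ i → pos i ≡ t % m
  pos-onto t = fromℕ< (m%n<n (t * k) n) , (begin
    (toℕ (fromℕ< (m%n<n (t * k) n)) / g * z) % m  ≡⟨ cong (λ x → (x / g * z) % m) (toℕ-fromℕ< _) ⟩
    ((t * k) % n / g * z) % m                     ≡⟨ cong (λ x → (x * z) % m) (quotient-mod (t * k)) ⟩
    ((t * k) / g % m * z) % m                     ≡⟨ %-cong-* m (m%n%n≡m%n _ m) refl ⟩
    ((t * k) / g * z) % m                         ≡⟨ cong (λ x → (x * z) % m) (*-/-assoc t (divides k' k≡)) ⟩
    (t * (k / g) * z) % m                         ≡⟨ cong (λ x → (t * x * z) % m) k/g≡k' ⟩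
    (t * k' * z) % m                              ≡⟨ cancel-k'z t ⟩
    t % m                                         ∎)
    where open ≡-Reasoning

  pos-zero⇒initial : ∀ i → pos i ≡ 0 → toℕ i < g
  pos-zero⇒initial i pos≡0 = m/n≡0⇒m<n (begin
    toℕ i / g             ≡⟨ m<n⇒m%n≡m t<m ⟨
    toℕ i / g % m         ≡⟨ cancel-k'z (toℕ i / g) ⟨
    (t * k' * z) % m      ≡⟨ cong (_% m) (xy∙z≈xz∙y t k' z) ⟩
    (t * z * k') % m      ≡⟨ %-cong-* m (trans pos≡0 (sym (0%m≡0 m))) refl ⟩
    (0 * k') % m          ≡⟨ 0%m≡0 m ⟩
    0                     ∎)
    where
    open ≡-Reasoning
    t : ℕ
    t = toℕ i / g
    t<m : t < m
    t<m = m<n*o⇒m/o<n (subst (toℕ i <_) n≡ (toℕ<n i))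
    0%m≡0 : ∀ m .{{_ : NonZero m}} → 0 % m ≡ 0
    0%m≡0 (suc _) = refl

  count-zeros : count (λ i → pos i ≡ᵇ 0) ≤ g
  count-zeros = ≤-trans (count-mono _ _ zero⇒initial) (count-initial {n} g)
    where
    zero⇒initial : ∀ i → (pos i ≡ᵇ 0) ≡ true → (toℕ i <ᵇ g) ≡ true
    zero⇒initial i h = Equivalence.to T-≡
      (<⇒<ᵇ (pos-zero⇒initial i (≡ᵇ⇒≡ (pos i) 0 (Equivalence.from T-≡ h))))

module PositionCovers {n k m} .{{_ : NonZero m}} (pos : Fin n → ℕ) (pos<m : ∀ i → pos i < m)
                      (pos-step : ∀ i → pos (i ⊕ k) ≡ suc (pos i) % m) where

  evens odds oddsOrZero zeros : Fin n → Bool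
  evens i = even (pos i)
  odds = not ∘ evens
  oddsOrZero i = not (even (pos i)) ∨ (pos i ≡ᵇ 0)
  zeros i = pos i ≡ᵇ 0

  step-cases : ∀ i → pos (i ⊕ k) ≡ suc (pos i) ⊎ (pos (i ⊕ k) ≡ 0 × suc (pos i) ≡ m)
  step-cases i with suc-mod (pos<m i)
  ... | inj₁ next≡ = inj₁ (trans (pos-step i) next≡)
  ... | inj₂ (next≡0 , wraps) = inj₂ (trans (pos-step i) next≡0 , wraps)

  next-parity : ∀ i → pos (i ⊕ k) ≡ suc (pos i) → even (pos (i ⊕ k)) ≡ not (even (pos i))
  next-parity i next≡ = trans (cong even next≡) (even-suc (pos i))

  -- The wrap-around edge ends at position 0, which is even.
  evens-cover : InnerCover n k evens
  evens-cover i = by-parity (even (pos i)) refl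
    where
    by-parity : ∀ b → even (pos i) ≡ b → evens i ≡ true ⊎ evens (i ⊕ k) ≡ true
    by-parity true  e = inj₁ e
    by-parity false e with step-cases i
    ... | inj₁ next≡ = inj₂ (trans (next-parity i next≡) (cong not e))
    ... | inj₂ (next≡0 , _) = inj₂ (cong even next≡0)

  -- With m even the wrap-around edge joins an odd position m - 1 to 0.
  odds-cover : even m ≡ true → InnerCover n k odds
  odds-cover m-even i = by-parity (even (pos i)) refl
    where
    by-parity : ∀ b → even (pos i) ≡ b → odds i ≡ true ⊎ odds (i ⊕ k) ≡ true
    by-parity false e = inj₁ (cong not e)
    by-parity true  e with step-cases i
    ... | inj₁ next≡ = inj₂ (cong not (trans (next-parity i next≡) (cong not e)))
    ... | inj₂ (_ , wraps) =
      contradiction (trans (sym m-even) (trans (cong even (sym wraps)) (trans (even-suc (pos i)) (cong not e))))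
                    λ ()

  -- Every edge leaves an odd position or enters one, except the wrap into 0.
  oddsOrZero-cover : InnerCover n k oddsOrZero
  oddsOrZero-cover i = by-parity (even (pos i)) refl
    where
    by-parity : ∀ b → even (pos i) ≡ b → oddsOrZero i ≡ true ⊎ oddsOrZero (i ⊕ k) ≡ true
    by-parity false e = inj₁ (cong (λ x → not x ∨ (pos i ≡ᵇ 0)) e)
    by-parity true  e with step-cases i
    ... | inj₁ next≡ = inj₂ (cong (λ x → not x ∨ (pos (i ⊕ k) ≡ᵇ 0)) (trans (next-parity i next≡) (cong not e)))
    ... | inj₂ (next≡0 , _) = inj₂ (cong (λ p → not (even p) ∨ (p ≡ᵇ 0)) next≡0)

  -- Every index is counted once, and indices at position 0 twice.
  count-evens+oddsOrZero : count evens + count oddsOrZero ≡ n + count zeros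
  count-evens+oddsOrZero = begin
    count evens + count oddsOrZero                          ≡⟨ count-+ evens oddsOrZero ⟩
    sum (λ i → ⟦ evens i ⟧ + ⟦ oddsOrZero i ⟧)              ≡⟨ sum-cong-≗ (pointwise ∘ pos) ⟩
    sum (λ i → 1 + ⟦ zeros i ⟧)                             ≡⟨ ∑-const+ 1 (⟦_⟧ ∘ zeros) ⟩
    n * 1 + sum (⟦_⟧ ∘ zeros)                               ≡⟨ cong₂ _+_ (sym (*-identityʳ n)) (count≡∑ zeros) ⟨
    n + count zeros                                         ∎
    where
    open ≡-Reasoning
    pointwise : ∀ p → ⟦ even p ⟧ + ⟦ not (even p) ∨ (p ≡ᵇ 0) ⟧ ≡ 1 + ⟦ p ≡ᵇ 0 ⟧
    pointwise zero = refl
    pointwise (suc p) with even (suc p)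
    ... | true  = refl
    ... | false = refl

-- n > 2k ≥ 2 forces the inner cycle length m to be at least 2:
-- otherwise n ≤ g ≤ k.
cycle-length≥2 : ∀ {n k g m} → 1 ≤ k → 2 * k < n → g ∣ k → n ≡ m * g → 2 ≤ m
cycle-length≥2 {n} {k} {g} {m} 1≤k 2k<n g∣k n≡ with 2 ≤? m
... | yes 2≤m = 2≤m
... | no 2≰m = contradiction 2k<n (≤⇒≯ (begin
  n      ≡⟨ n≡ ⟩
  m * g  ≤⟨ *-monoˡ-≤ g (≤-pred (≰⇒> 2≰m)) ⟩
  1 * g  ≡⟨ *-identityˡ g ⟩
  g      ≤⟨ ∣⇒≤ g∣k ⟩
  k      ≤⟨ m≤n*m k 2 ⟩
  2 * k  ∎))
  where
  open ≤-Reasoning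
  instance
    k≢0 : NonZero k
    k≢0 = >-nonZero 1≤k

β≤-by-cycles : ∀ {n k m g k'} .{{_ : NonZero n}} .{{_ : NonZero m}} .{{_ : NonZero g}} →
  n ≡ m * g → k ≡ k' * g → Coprime m k' → 2 ≤ m →
  (m % 2 ≡ 1 → β≤ n k ((4 * n + (n + g)) / 4)) × (m % 2 ≡ 0 → β≤ n k ((4 * n + n) / 4))
β≤-by-cycles {n} {k} {m} {g} n≡ k≡ coprime 2≤m = odd-case , even-case
  where
  open InnerPositions n≡ k≡ coprime
  open PositionCovers pos pos<m pos-step

  at : ∀ t → t < m → ∃ λ i → pos i ≡ t
  at t t<m with pos-onto t
  ... | i , pos≡ = i , trans pos≡ (m<n⇒m%n≡m t<m)

  -- Inner covers "even" and "odd or zero"; m ≥ 3 provides the index at position 2.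
  odd-case : m % 2 ≡ 1 → β≤ n k ((4 * n + (n + g)) / 4)
  odd-case m-odd with at 1 2≤m | at 2 3≤m
    where
    3≤m : 3 ≤ m
    3≤m with m≤n⇒m<n∨m≡n 2≤m
    ... | inj₁ 2<m = 2<m
    ... | inj₂ 2≡m = contradiction (trans (cong (_% 2) 2≡m) m-odd) λ ()
  ... | i₁ , pos≡1 | i₂ , pos≡2 =
    β≤-from-inner-covers evens-cover (cong even pos≡1)
                         oddsOrZero-cover (cong (λ p → not (even p) ∨ (p ≡ᵇ 0)) pos≡2)
                         (+-monoʳ-≤ (4 * n) (begin
      count evens + count oddsOrZero  ≡⟨ count-evens+oddsOrZero ⟩
      n + count zeros                 ≤⟨ +-monoʳ-≤ n count-zeros ⟩
      n + g                           ∎))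
    where open ≤-Reasoning

  even-case : m % 2 ≡ 0 → β≤ n k ((4 * n + n) / 4)
  even-case m-even with at 0 (≤-trans (s≤s z≤n) 2≤m) | at 1 2≤m
  ... | i₀ , pos≡0 | i₁ , pos≡1 =
    β≤-from-inner-covers evens-cover (cong even pos≡1)
                         (odds-cover (%2≡0⇒even m m-even)) (cong (not ∘ even) pos≡0)
                         (≤-reflexive (cong (4 * n +_) (count-complement evens)))

proposition9 : (n k : ℕ) → 1 ≤ k → 2 * k < n →
    ((nOverG n k % 2 ≡ 1 → (β≤ n k ((4 * n + (n + gcd n k)) / 4)))
    × (nOverG n k % 2 ≡ 0 → (β≤ n k ((4 * n + n) / 4))))
proposition9 zero k _ ()
proposition9 n@(suc _) k 1≤k 2k<n =
  β≤-by-cycles {{_}} {{m≢0}} {{g≢0}} n≡ k≡ (coprime-/gcd n k {{g≢0}}) 2≤m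
  where
  g≢0 : NonZero (gcd n k)
  g≢0 = ≢-nonZero (gcd[m,n]≢0 n k (inj₁ λ ()))
  n≡ : n ≡ (n / gcd n k) {{g≢0}} * gcd n k
  n≡ = sym (m/n*n≡m {{g≢0}} (gcd[m,n]∣m n k))
  k≡ : k ≡ (k / gcd n k) {{g≢0}} * gcd n k
  k≡ = sym (m/n*n≡m {{g≢0}} (gcd[m,n]∣n n k))
  2≤m : 2 ≤ (n / gcd n k) {{g≢0}}
  2≤m = cycle-length≥2 1≤k 2k<n (gcd[m,n]∣n n k) n≡
  m≢0 : NonZero ((n / gcd n k) {{g≢0}})
  m≢0 = >-nonZero (≤-trans (s≤s z≤n) 2≤m)
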